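{- Let $C$ be a constant-free arithmetic circuit of size $t$ and formal degree $d$, whose arithmetic gates are multiplication gates, unweighted addition gates or subtraction gates, all of fan-in 2. Then there is a constant-free circuit $C'$ computing the same polynomial as $C$, of formal degree $d+1$ and size at most $6t+3$, whose arithmetic gates are binary multiplication gates or ordinary (binary unweighted) addition gates.
   Context: An arithmetic circuit is a directed acyclic graph whose input gates are labelled by variables or constants and whose other gates are addition or multiplication gates; each input gate has fan-out at most 1. A circuit is constant-free if the only constants labelling input gates are from $\{ -1,0,1\}$; it then computes a polynomial with integer coefficients. A subtraction gate with inputs $x,y$ computes $x-y$. The size of a circuit is its total number of gates, including input gates. Formal degree: an input gate has formal degree 1; an addition or subtraction gate has formal degree equal to the maximum of the formal degrees of its inputs; a multiplication gate has formal degree equal to the sum of the formal degrees of its inputs; the formal degree of the circuit is that of its output gate. -}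

module Defs where

open import Level using (0ℓ)
open import Data.Nat using (ℕ; zero; suc; _+_; _⊔_; _≤_)
open import Data.Fin using (Fin; _≟_)
open import Data.Vec using (Vec; []; _∷ʳ_; lookup; tabulate; zipWith; last)
open import Data.Bool using (Bool; true; false; if_then_else_)
open import Relation.Nullary.Decidable using (⌊_⌋)
open import Relation.Binary.PropositionalEquality using (_≡_)
open import Algebra.Bundles using (CommutativeRing)
open import Data.Unit using (⊤)
open import Data.Product using (_×_)

-- Constants allowed in a constant-free circuit: -1, 0, 1.
data Const : Set where
  minus-one zero-c one-c : Const

-- A gate placed at position i of a circuit; arithmetic gates have fan-in 2
-- and refer to earlier gates (indices in Fin i), so the circuit is a DAG.
data Gate (i : ℕ) : Set where
  var : ℕ → Gate i
  cst : Const → Gate i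
  add : Fin i → Fin i → Gate i
  mul : Fin i → Fin i → Gate i
  sub : Fin i → Fin i → Gate i

-- The size of a circuit of type Circ n is n (all gates, input gates included).
-- For a nonempty circuit the output gate is the last gate.
data Circ : ℕ → Set where
  []  : Circ 0
  _▷_ : ∀ {n} → Circ n → Gate n → Circ (suc n)

module _ (R : CommutativeRing 0ℓ 0ℓ) where
  open CommutativeRing R using (Carrier; 0#; 1#) renaming (_+_ to _+R_; _*_ to _*R_; _-_ to _-R_; -_ to -R_)

  constVal : Const → Carrier
  constVal minus-one = -R 1#
  constVal zero-c = 0#
  constVal one-c = 1#

  gateVal : ∀ {n} → (ℕ → Carrier) → Vec Carrier n → Gate n → Carrier
  gateVal ρ v (var k) = ρ k
  gateVal ρ v (cst c) = constVal c
  gateVal ρ v (add a b) = lookup v a +R lookup v b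
  gateVal ρ v (mul a b) = lookup v a *R lookup v b
  gateVal ρ v (sub a b) = lookup v a -R lookup v b

  values : ∀ {n} → Circ n → (ℕ → Carrier) → Vec Carrier n
  values [] ρ = []
  values (C ▷ g) ρ = values C ρ ∷ʳ gateVal ρ (values C ρ) g

  output : ∀ {n} → Circ (suc n) → (ℕ → Carrier) → Carrier
  output C ρ = last (values C ρ)

gateDeg : ∀ {n} → Vec ℕ n → Gate n → ℕ
gateDeg v (var _) = 1
gateDeg v (cst _) = 1
gateDeg v (add a b) = lookup v a ⊔ lookup v b
gateDeg v (mul a b) = lookup v a + lookup v b
gateDeg v (sub a b) = lookup v a ⊔ lookup v b

degrees : ∀ {n} → Circ n → Vec ℕ n
degrees [] = []
degrees (C ▷ g) = degrees C ∷ʳ gateDeg (degrees C) g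

formalDegree : ∀ {n} → Circ (suc n) → ℕ
formalDegree C = last (degrees C)

ind : ∀ {n} → Fin n → Fin n → ℕ
ind a k = if ⌊ k ≟ a ⌋ then 1 else 0

refCount : ∀ {n} → Gate n → Vec ℕ n
refCount (var _) = tabulate (λ _ → 0)
refCount (cst _) = tabulate (λ _ → 0)
refCount (add a b) = tabulate (λ k → ind a k + ind b k)
refCount (mul a b) = tabulate (λ k → ind a k + ind b k)
refCount (sub a b) = tabulate (λ k → ind a k + ind b k)

fanouts : ∀ {n} → Circ n → Vec ℕ n
fanouts [] = []
fanouts (C ▷ g) = zipWith _+_ (fanouts C) (refCount g) ∷ʳ 0

isInputGate : ∀ {n} → Gate n → Bool
isInputGate (var _) = true
isInputGate (cst _) = true
isInputGate _ = false

isInputs : ∀ {n} → Circ n → Vec Bool n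
isInputs [] = []
isInputs (C ▷ g) = isInputs C ∷ʳ isInputGate g

InputFanoutOK : ∀ {n} → Circ n → Set
InputFanoutOK {n} C = (j : Fin n) → lookup (isInputs C) j ≡ true → lookup (fanouts C) j ≤ 1

isSub : ∀ {n} → Gate n → Bool
isSub (sub _ _) = true
isSub _ = false

NoSub : ∀ {n} → Circ n → Set
NoSub [] = ⊤
NoSub (C ▷ g) = (isSub g ≡ false) × NoSub C

module Submission where

-- Proof idea (the paper's): every gate v of C is simulated by a PAIR of
-- subtraction-free gates v⁺, v⁻ of a new circuit D, neither of them an input
-- gate, both of the formal degree of v, with  v = v⁺ - v⁻.  Gates of C are
-- processed in topological order, each costing at most 6 new gates of D:
--   input x   : x⁺ = x + 0,  x⁻ = 0 + 0                        (6 gates)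
--   a + b     : (a⁺ + b⁺) - (a⁻ + b⁻)                          (2 gates)
--   a - b     : (a⁺ + b⁻) - (a⁻ + b⁺)                          (2 gates)
--   a * b     : (a⁺b⁺ + a⁻b⁻) - (a⁺b⁻ + a⁻b⁺)                  (6 gates)
-- Because v⁺, v⁻ are never input gates they may be reused freely, while each
-- fresh input gate is wired exactly once.  Finally the output is recovered
-- as  out⁺ + (-1) * out⁻  with 3 more gates, of formal degree d + 1.

open import Level using (0ℓ)
open import Algebra.Bundles using (CommutativeRing)

-- The identities justifying each simulation rule, in any commutative ring.
-- (Placed before the arithmetic on ℕ is imported, so that _+_ and _*_ here
-- unambiguously denote the ring operations.)
module RingIdentities (R : CommutativeRing 0ℓ 0ℓ) where
  open CommutativeRing R
  open import Algebra.Properties.Ring ring using (-1*x≈-x; x[y-z]≈xy-xz; [y-z]x≈yx-zx)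
  open import Algebra.Properties.AbelianGroup +-abelianGroup using (⁻¹-∙-comm; ⁻¹-anti-homo‿-; ε⁻¹≈ε)
  open import Algebra.Properties.CommutativeSemigroup +-commutativeSemigroup using (interchange)
  open import Relation.Binary.Reasoning.Setoid setoid

  sum-difference : ∀ a b c d → (a + c) - (b + d) ≈ (a - b) + (c - d)
  sum-difference a b c d = begin
    (a + c) + - (b + d)   ≈⟨ +-congˡ (⁻¹-∙-comm b d) ⟨
    (a + c) + (- b + - d) ≈⟨ interchange a c (- b) (- d) ⟩
    (a - b) + (c - d)     ∎

  crossed-difference : ∀ a b c d → (a + d) - (b + c) ≈ (a - b) - (c - d)
  crossed-difference a b c d = begin
    (a + d) - (b + c)   ≈⟨ sum-difference a b d c ⟩
    (a - b) + (d - c)   ≈⟨ +-congˡ (⁻¹-anti-homo‿- c d) ⟨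
    (a - b) - (c - d)   ∎

  product-difference : ∀ a b c d → (a * c + b * d) - (a * d + b * c) ≈ (a - b) * (c - d)
  product-difference a b c d = begin
    (a * c + b * d) - (a * d + b * c)   ≈⟨ crossed-difference (a * c) (a * d) (b * c) (b * d) ⟩
    (a * c - a * d) - (b * c - b * d)   ≈⟨ +-cong (sym (x[y-z]≈xy-xz a c d)) (-‿cong (sym (x[y-z]≈xy-xz b c d))) ⟩
    a * (c - d) - b * (c - d)           ≈⟨ [y-z]x≈yx-zx (c - d) a b ⟨
    (a - b) * (c - d)                   ∎

  input-difference : ∀ a → (a + 0#) - (0# + 0#) ≈ a
  input-difference a = begin
    (a + 0#) - (0# + 0#) ≈⟨ +-cong (+-identityʳ a) (-‿cong (+-identityʳ 0#)) ⟩
    a - 0#               ≈⟨ +-congˡ ε⁻¹≈ε ⟩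
    a + 0#               ≈⟨ +-identityʳ a ⟩
    a                    ∎

  minus-one-difference : ∀ a b → a + - 1# * b ≈ a - b
  minus-one-difference a b = +-congˡ (-1*x≈-x b)

open import Defs
open import Data.Nat using (ℕ; zero; suc; _+_; _*_; _≤_; _⊔_; z≤n)
open import Data.Nat.Properties
  using (≤-refl; ≤-trans; ≤-reflexive; +-identityʳ; +-comm; +-monoˡ-≤; +-monoʳ-≤; m≤m+n; *-suc; ⊔-idem; m≤n⇒m⊔n≡n; n≤1+n)
open import Data.Fin using (Fin; fromℕ; inject₁; _≟_) renaming (zero to fzero; suc to fsuc)
open import Data.Fin.Properties using (fromℕ≢inject₁)
open import Data.Vec using (Vec; []; _∷_; _∷ʳ_; lookup; last; zipWith)
open import Data.Vec.Properties using (lookup-zipWith; lookup∘tabulate)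
open import Data.Bool using (Bool; true; false)
open import Data.Product using (Σ; _×_; _,_)
open import Data.Unit using (tt)
open import Data.Empty using (⊥-elim)
open import Relation.Nullary using (Dec; yes; no; ¬_)
open import Relation.Binary.PropositionalEquality
  using (_≡_; refl; sym; trans; cong; cong₂; subst; module ≡-Reasoning)

module _ {a} {A : Set a} where

  lookup-∷ʳ-inject₁ : ∀ {n} (v : Vec A n) (x : A) (j : Fin n) → lookup (v ∷ʳ x) (inject₁ j) ≡ lookup v j
  lookup-∷ʳ-inject₁ (y ∷ v) x fzero    = refl
  lookup-∷ʳ-inject₁ (y ∷ v) x (fsuc j) = lookup-∷ʳ-inject₁ v x j

  lookup-∷ʳ-fromℕ : ∀ {n} (v : Vec A n) (x : A) → lookup (v ∷ʳ x) (fromℕ n) ≡ x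
  lookup-∷ʳ-fromℕ []      x = refl
  lookup-∷ʳ-fromℕ (y ∷ v) x = lookup-∷ʳ-fromℕ v x

  last≡lookup-fromℕ : ∀ {n} (v : Vec A (suc n)) → last v ≡ lookup v (fromℕ n)
  last≡lookup-fromℕ (x ∷ [])    = refl
  last≡lookup-fromℕ (x ∷ y ∷ v) = last≡lookup-fromℕ (y ∷ v)

last-or-inject₁ : ∀ {ℓ n} (P : Fin (suc n) → Set ℓ) → P (fromℕ n) → (∀ j → P (inject₁ j)) → ∀ i → P i
last-or-inject₁ {n = zero}  P p-last p-old fzero    = p-last
last-or-inject₁ {n = suc n} P p-last p-old fzero    = p-old fzero
last-or-inject₁ {n = suc n} P p-last p-old (fsuc i) =
  last-or-inject₁ (λ j → P (fsuc j)) p-last (λ j → p-old (fsuc j)) i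

Legal : ∀ {m} → Circ m → Set
Legal D = InputFanoutOK D × NoSub D

true≢false : ∀ {x : Bool} → x ≡ true → ¬ (x ≡ false)
true≢false refl ()

-- A gate may receive one more wire: if it is an input gate, it is unused.
Available : ∀ {m} → Circ m → Fin m → Set
Available D j = lookup (isInputs D) j ≡ true → lookup (fanouts D) j ≡ 0

NotSameInput : ∀ {m} → Circ m → Fin m → Fin m → Set
NotSameInput D a b = a ≡ b → lookup (isInputs D) a ≡ false

ind-self : ∀ {n} (a : Fin n) → ind a a ≡ 1
ind-self a with a ≟ a
... | yes _   = refl
... | no  a≢a = ⊥-elim (a≢a refl)

ind-other : ∀ {n} {a j : Fin n} → ¬ (j ≡ a) → ind a j ≡ 0
ind-other {a = a} {j} j≢a with j ≟ a
... | yes j≡a = ⊥-elim (j≢a j≡a)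
... | no  _   = refl

fanout-old : ∀ {m} (D : Circ m) (h : Gate m) (j : Fin m) →
  lookup (fanouts (D ▷ h)) (inject₁ j) ≡ lookup (fanouts D) j + lookup (refCount h) j
fanout-old D h j =
  trans (lookup-∷ʳ-inject₁ (zipWith _+_ (fanouts D) (refCount h)) 0 j) (lookup-zipWith _+_ j (fanouts D) (refCount h))

snoc-fanout-ok : ∀ {m} (D : Circ m) (h : Gate m) → InputFanoutOK D →
  (∀ j → lookup (isInputs D) j ≡ true → lookup (fanouts D) j + lookup (refCount h) j ≤ 1) →
  InputFanoutOK (D ▷ h)
snoc-fanout-ok D h ok bound = last-or-inject₁ _ new-gate old-gate
  where
  new-gate : lookup (isInputs (D ▷ h)) (fromℕ _) ≡ true → lookup (fanouts (D ▷ h)) (fromℕ _) ≤ 1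
  new-gate _ = subst (_≤ 1) (sym (lookup-∷ʳ-fromℕ (zipWith _+_ (fanouts D) (refCount h)) 0)) z≤n
  old-gate : ∀ j → lookup (isInputs (D ▷ h)) (inject₁ j) ≡ true → lookup (fanouts (D ▷ h)) (inject₁ j) ≤ 1
  old-gate j input = subst (_≤ 1) (sym (fanout-old D h j))
    (bound j (trans (sym (lookup-∷ʳ-inject₁ (isInputs D) _ j)) input))

input-refs : ∀ {m} (h : Gate m) → isInputGate h ≡ true → ∀ j → lookup (refCount h) j ≡ 0
input-refs (var _) _ j = lookup∘tabulate (λ _ → 0) j
input-refs (cst _) _ j = lookup∘tabulate (λ _ → 0) j

input-fanout-ok : ∀ {m} (D : Circ m) (h : Gate m) → isInputGate h ≡ true →
  InputFanoutOK D → InputFanoutOK (D ▷ h)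
input-fanout-ok D h is-input ok = snoc-fanout-ok D h ok bound
  where
  bound : ∀ j → lookup (isInputs D) j ≡ true → lookup (fanouts D) j + lookup (refCount h) j ≤ 1
  bound j input rewrite input-refs h is-input j | +-identityʳ (lookup (fanouts D) j) = ok j input

data Op : Set where
  op+ op* : Op

opGate : ∀ {m} → Op → Fin m → Fin m → Gate m
opGate op+ = add
opGate op* = mul

opGate-refs : ∀ {m} (o : Op) (a b j : Fin m) → lookup (refCount (opGate o a b)) j ≡ ind a j + ind b j
opGate-refs op+ a b j = lookup∘tabulate (λ k → ind a k + ind b k) j
opGate-refs op* a b j = lookup∘tabulate (λ k → ind a k + ind b k) j

binary-fanout-ok : ∀ {m} (D : Circ m) (o : Op) {a b : Fin m} → Available D a → Available D b →
  NotSameInput D a b → InputFanoutOK D → InputFanoutOK (D ▷ opGate o a b)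
binary-fanout-ok D o {a} {b} a-free b-free distinct ok = snoc-fanout-ok D (opGate o a b) ok bound
  where
  count : ∀ j → Dec (j ≡ a) → Dec (j ≡ b) → lookup (isInputs D) j ≡ true →
    lookup (fanouts D) j + (ind a j + ind b j) ≤ 1
  count j (yes refl) _ input
    rewrite a-free input | ind-self j | ind-other {a = b} {j} (λ j≡b → true≢false input (distinct j≡b)) = ≤-refl
  count j (no j≢a) (yes refl) input rewrite b-free input | ind-self j | ind-other {a = a} {j} j≢a = ≤-refl
  count j (no j≢a) (no j≢b) input
    rewrite ind-other {a = a} {j} j≢a | ind-other {a = b} {j} j≢b | +-identityʳ (lookup (fanouts D) j) = ok j input
  bound : ∀ j → lookup (isInputs D) j ≡ true → lookup (fanouts D) j + lookup (refCount (opGate o a b)) j ≤ 1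
  bound j input rewrite opGate-refs o a b j = count j (j ≟ a) (j ≟ b) input

opGate-not-sub : ∀ {m} o {a b : Fin m} → isSub (opGate o a b) ≡ false
opGate-not-sub op+ = refl
opGate-not-sub op* = refl

input-legal : ∀ {m} (D : Circ m) (h : Gate m) → isInputGate h ≡ true → Legal D → Legal (D ▷ h)
input-legal D (var x) is-input (ok , no-sub) = input-fanout-ok D (var x) is-input ok , refl , no-sub
input-legal D (cst c) is-input (ok , no-sub) = input-fanout-ok D (cst c) is-input ok , refl , no-sub

binary-legal : ∀ {m} (D : Circ m) (o : Op) {a b : Fin m} → Available D a → Available D b →
  NotSameInput D a b → Legal D → Legal (D ▷ opGate o a b)
binary-legal D o a-free b-free distinct (ok , no-sub) =
  binary-fanout-ok D o a-free b-free distinct ok , opGate-not-sub o , no-sub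

-- Polynomials, represented by their evaluations in all commutative rings

Poly : Set₁
Poly = (R : CommutativeRing 0ℓ 0ℓ) → (ℕ → CommutativeRing.Carrier R) → CommutativeRing.Carrier R

infixl 6 _⊕_ _⊖_
infixl 7 _⊗_
infix 4 _≋_

_⊕_ _⊖_ _⊗_ : Poly → Poly → Poly
(f ⊕ g) R ρ = CommutativeRing._+_ R (f R ρ) (g R ρ)
(f ⊖ g) R ρ = CommutativeRing._-_ R (f R ρ) (g R ρ)
(f ⊗ g) R ρ = CommutativeRing._*_ R (f R ρ) (g R ρ)

_≋_ : Poly → Poly → Set₁
f ≋ g = ∀ R ρ → CommutativeRing._≈_ R (f R ρ) (g R ρ)

≋-refl : ∀ {f} → f ≋ f
≋-refl R ρ = CommutativeRing.refl R

≋-trans : ∀ {f g h} → f ≋ g → g ≋ h → f ≋ h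
≋-trans f≋g g≋h R ρ = CommutativeRing.trans R (f≋g R ρ) (g≋h R ρ)

gateValue : ∀ {m} → Circ m → Fin m → Poly
gateValue D j R ρ = lookup (values R D ρ) j

gatePoly : ∀ {m} → Circ m → Gate m → Poly
gatePoly D h R ρ = gateVal R ρ (values R D ρ) h

opPoly : Op → Poly → Poly → Poly
opPoly op+ = _⊕_
opPoly op* = _⊗_

opDeg : Op → ℕ → ℕ → ℕ
opDeg op+ = _⊔_
opDeg op* = _+_

opPoly-cong : ∀ o {f f' g g'} → f ≋ f' → g ≋ g' → opPoly o f g ≋ opPoly o f' g'
opPoly-cong op+ f≋f' g≋g' R ρ = CommutativeRing.+-cong R (f≋f' R ρ) (g≋g' R ρ)
opPoly-cong op* f≋f' g≋g' R ρ = CommutativeRing.*-cong R (f≋f' R ρ) (g≋g' R ρ)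

opGate-value : ∀ {m} o (D : Circ m) (a b : Fin m) → gatePoly D (opGate o a b) ≋ opPoly o (gateValue D a) (gateValue D b)
opGate-value op+ D a b = ≋-refl
opGate-value op* D a b = ≋-refl

opGate-degree : ∀ {m} o (v : Vec ℕ m) (a b : Fin m) → gateDeg v (opGate o a b) ≡ opDeg o (lookup v a) (lookup v b)
opGate-degree op+ v a b = refl
opGate-degree op* v a b = refl

opGate-not-input : ∀ {m} o {a b : Fin m} → isInputGate (opGate o a b) ≡ false
opGate-not-input op+ = refl
opGate-not-input op* = refl

input-degree : ∀ {m} (v : Vec ℕ m) (h : Gate m) → isInputGate h ≡ true → gateDeg v h ≡ 1
input-degree v (var _) _ = refl
input-degree v (cst _) _ = refl

infix 4 _⊑_
record _⊑_ {m k} (D : Circ m) (E : Circ k) : Set₁ where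
  field
    embed        : Fin m → Fin k
    embed-value  : ∀ j → gateValue E (embed j) ≋ gateValue D j
    embed-degree : ∀ j → lookup (degrees E) (embed j) ≡ lookup (degrees D) j
    embed-input  : ∀ j → lookup (isInputs E) (embed j) ≡ lookup (isInputs D) j
    keeps-legal  : Legal D → Legal E
open _⊑_

snoc-⊑ : ∀ {m} (D : Circ m) (h : Gate m) → (Legal D → Legal (D ▷ h)) → D ⊑ D ▷ h
snoc-⊑ D h legal-step = record
  { embed        = inject₁
  ; embed-value  = λ j R ρ → CommutativeRing.reflexive R (lookup-∷ʳ-inject₁ (values R D ρ) _ j)
  ; embed-degree = lookup-∷ʳ-inject₁ (degrees D) _
  ; embed-input  = lookup-∷ʳ-inject₁ (isInputs D) _
  ; keeps-legal  = legal-step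
  }

⊑-trans : ∀ {m k l} {D : Circ m} {E : Circ k} {F : Circ l} → D ⊑ E → E ⊑ F → D ⊑ F
⊑-trans D⊑E E⊑F = record
  { embed        = λ j → embed E⊑F (embed D⊑E j)
  ; embed-value  = λ j → ≋-trans (embed-value E⊑F (embed D⊑E j)) (embed-value D⊑E j)
  ; embed-degree = λ j → trans (embed-degree E⊑F (embed D⊑E j)) (embed-degree D⊑E j)
  ; embed-input  = λ j → trans (embed-input E⊑F (embed D⊑E j)) (embed-input D⊑E j)
  ; keeps-legal  = λ legal → keeps-legal E⊑F (keeps-legal D⊑E legal)
  }

-- A non-input gate of D computing f, of formal degree d.  Such gates may be
-- used as arguments any number of times.
record Inner {m} (D : Circ m) (f : Poly) (d : ℕ) : Set₁ where
  field
    gate      : Fin m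
    not-input : lookup (isInputs D) gate ≡ false
    degree    : lookup (degrees D) gate ≡ d
    computes  : gateValue D gate ≋ f
open Inner

infixl 5 _↑_
_↑_ : ∀ {m k} {D : Circ m} {E : Circ k} {f d} → Inner D f d → D ⊑ E → Inner E f d
x ↑ D⊑E = record
  { gate      = embed D⊑E (gate x)
  ; not-input = trans (embed-input D⊑E (gate x)) (not-input x)
  ; degree    = trans (embed-degree D⊑E (gate x)) (degree x)
  ; computes  = ≋-trans (embed-value D⊑E (gate x)) (computes x)
  }

record Operand {m} (D : Circ m) (f : Poly) (d : ℕ) : Set₁ where
  field
    gate      : Fin m
    available : Available D gate
    degree    : lookup (degrees D) gate ≡ d
    computes  : gateValue D gate ≋ f

inner-operand : ∀ {m} {D : Circ m} {f d} → Inner D f d → Operand D f d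
inner-operand x = record
  { gate      = gate x
  ; available = λ input → ⊥-elim (true≢false input (not-input x))
  ; degree    = degree x
  ; computes  = computes x
  }

fresh-input : ∀ {m} (D : Circ m) (h : Gate m) → isInputGate h ≡ true → Operand (D ▷ h) (gatePoly D h) 1
fresh-input D h is-input = record
  { gate      = fromℕ _
  ; available = λ _ → lookup-∷ʳ-fromℕ (zipWith _+_ (fanouts D) (refCount h)) 0
  ; degree    = trans (lookup-∷ʳ-fromℕ (degrees D) _) (input-degree (degrees D) h is-input)
  ; computes  = λ R ρ → CommutativeRing.reflexive R (lookup-∷ʳ-fromℕ (values R D ρ) _)
  }

operand-after-input : ∀ {m} {D : Circ m} {f d} (h : Gate m) → isInputGate h ≡ true →
  Operand D f d → Operand (D ▷ h) f d
operand-after-input {D = D} h is-input x = record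
  { gate      = inject₁ j
  ; available = still-available
  ; degree    = trans (lookup-∷ʳ-inject₁ (degrees D) _ j) (Operand.degree x)
  ; computes  = λ R ρ → CommutativeRing.trans R
      (CommutativeRing.reflexive R (lookup-∷ʳ-inject₁ (values R D ρ) _ j)) (Operand.computes x R ρ)
  }
  where
  j = Operand.gate x
  still-available : Available (D ▷ h) (inject₁ j)
  still-available input = begin
    lookup (fanouts (D ▷ h)) (inject₁ j)          ≡⟨ fanout-old D h j ⟩
    lookup (fanouts D) j + lookup (refCount h) j  ≡⟨ cong₂ _+_ (Operand.available x unchanged) (input-refs h is-input j) ⟩
    0                                             ∎
    where
    open ≡-Reasoning
    unchanged = trans (sym (lookup-∷ʳ-inject₁ (isInputs D) _ j)) input

opOn : ∀ {m} {D : Circ m} {f d f' d'} → Op → Operand D f d → Operand D f' d' → Gate m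
opOn o x y = opGate o (Operand.gate x) (Operand.gate y)

append : ∀ {m} {D : Circ m} {f d f' d'} (o : Op) (x : Operand D f d) (y : Operand D f' d') →
  NotSameInput D (Operand.gate x) (Operand.gate y) →
  D ⊑ D ▷ opOn o x y × Inner (D ▷ opOn o x y) (opPoly o f f') (opDeg o d d')
append {m} {D} o x y distinct =
  snoc-⊑ D h (binary-legal D o (Operand.available x) (Operand.available y) distinct) , new-gate
  where
  h = opOn o x y
  new-gate : Inner (D ▷ h) _ _
  new-gate = record
    { gate      = fromℕ m
    ; not-input = trans (lookup-∷ʳ-fromℕ (isInputs D) _) (opGate-not-input o)
    ; degree    = trans (lookup-∷ʳ-fromℕ (degrees D) _)
        (trans (opGate-degree o (degrees D) _ _) (cong₂ (opDeg o) (Operand.degree x) (Operand.degree y)))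
    ; computes  = λ R ρ → CommutativeRing.trans R (CommutativeRing.reflexive R (lookup-∷ʳ-fromℕ (values R D ρ) _))
        (≋-trans (opGate-value o D _ _) (opPoly-cong o (Operand.computes x) (Operand.computes y)) R ρ)
    }

append-inner : ∀ {m} {D : Circ m} {f d f' d'} (o : Op) (x : Inner D f d) (y : Inner D f' d') →
  let h = opGate o (gate x) (gate y) in D ⊑ D ▷ h × Inner (D ▷ h) (opPoly o f f') (opDeg o d d')
append-inner o x y = append o (inner-operand x) (inner-operand y) (λ _ → not-input x)

record Difference {m} (D : Circ m) (f : Poly) (d : ℕ) : Set₁ where
  field
    {f⁺ f⁻}    : Poly
    positive   : Inner D f⁺ d
    negative   : Inner D f⁻ d
    difference : f⁺ ⊖ f⁻ ≋ f
open Difference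

difference-lift : ∀ {m k} {D : Circ m} {E : Circ k} {f d} → D ⊑ E → Difference D f d → Difference E f d
difference-lift D⊑E x = record
  { positive = positive x ↑ D⊑E ; negative = negative x ↑ D⊑E ; difference = difference x }

difference-cong : ∀ {m} {D : Circ m} {f f' d d'} → f ≋ f' → d ≡ d' → Difference D f d → Difference D f' d'
difference-cong f≋f' refl x = record
  { positive = positive x ; negative = negative x ; difference = ≋-trans (difference x) f≋f' }

Encoding : ∀ {n m} → Circ n → Circ m → Set₁
Encoding {n} C D = (i : Fin n) → Difference D (gateValue C i) (lookup (degrees C) i)

encoding-lift : ∀ {n m k} {C : Circ n} {D : Circ m} {E : Circ k} → D ⊑ E → Encoding C D → Encoding C E
encoding-lift D⊑E enc i = difference-lift D⊑E (enc i)

encoding-snoc : ∀ {n m} {C : Circ n} {D : Circ m} (g : Gate n) → Encoding C D →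
  Difference D (gatePoly C g) (gateDeg (degrees C) g) → Encoding (C ▷ g) D
encoding-snoc {C = C} g enc new = last-or-inject₁ _ new-gate old-gate
  where
  new-gate = difference-cong (λ R ρ → CommutativeRing.reflexive R (sym (lookup-∷ʳ-fromℕ (values R C ρ) _)))
                             (sym (lookup-∷ʳ-fromℕ (degrees C) _)) new
  old-gate = λ j → difference-cong (λ R ρ → CommutativeRing.reflexive R (sym (lookup-∷ʳ-inject₁ (values R C ρ) _ j)))
                                   (sym (lookup-∷ʳ-inject₁ (degrees C) _ j)) (enc j)

record Block {m} (D : Circ m) (bound : ℕ) (f : Poly) (d : ℕ) : Set₁ where
  constructor block
  field
    {size}  : ℕ
    circuit : Circ size
    small   : size ≤ bound
    extends : D ⊑ circuit
    result  : Difference circuit f d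

block-weaken : ∀ {m b b' f d} {D : Circ m} → b ≤ b' → Block D b f d → Block D b' f d
block-weaken b≤b' (block F small D⊑F result) = block F (≤-trans small b≤b') D⊑F result

block-cong : ∀ {m b f f' d d'} {D : Circ m} → f ≋ f' → d ≡ d' → Block D b f d → Block D b f' d'
block-cong f≋f' d≡d' (block F small D⊑F result) = block F small D⊑F (difference-cong f≋f' d≡d' result)

block-after : ∀ {m k b f d} {D : Circ m} {E : Circ k} → D ⊑ E → Block E b f d → Block D b f d
block-after D⊑E (block F small E⊑F result) = block F small (⊑-trans D⊑E E⊑F) result

difference-of-sums : ∀ {m} {D : Circ m} {f₁ g₁ f₂ g₂ d₁ d₂} →
  Inner D f₁ d₁ → Inner D g₁ d₂ → Inner D f₂ d₁ → Inner D g₂ d₂ →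
  Block D (2 + m) (f₁ ⊕ g₁ ⊖ (f₂ ⊕ g₂)) (d₁ ⊔ d₂)
difference-of-sums x₁ y₁ x₂ y₂ =
  let e₁ , s₁ = append-inner op+ x₁ y₁
      e₂ , s₂ = append-inner op+ (x₂ ↑ e₁) (y₂ ↑ e₁)
  in block _ ≤-refl (⊑-trans e₁ e₂) (record { positive = s₁ ↑ e₂ ; negative = s₂ ; difference = ≋-refl })

addition-block : ∀ {m} {D : Circ m} {f g d e} → Difference D f d → Difference D g e → Block D (6 + m) (f ⊕ g) (d ⊔ e)
addition-block {m} x y = block-weaken (+-monoˡ-≤ m (m≤m+n 2 4)) (block-cong rearrange refl
  (difference-of-sums (positive x) (positive y) (negative x) (negative y)))
  where
  rearrange : _ ≋ _
  rearrange R ρ = CommutativeRing.trans R (RingIdentities.sum-difference R _ _ _ _)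
                    (CommutativeRing.+-cong R (difference x R ρ) (difference y R ρ))

subtraction-block : ∀ {m} {D : Circ m} {f g d e} → Difference D f d → Difference D g e → Block D (6 + m) (f ⊖ g) (d ⊔ e)
subtraction-block {m} x y = block-weaken (+-monoˡ-≤ m (m≤m+n 2 4)) (block-cong rearrange refl
  (difference-of-sums (positive x) (negative y) (negative x) (positive y)))
  where
  rearrange : _ ≋ _
  rearrange R ρ = CommutativeRing.trans R (RingIdentities.crossed-difference R _ _ _ _)
                    (CommutativeRing.+-cong R (difference x R ρ) (CommutativeRing.-‿cong R (difference y R ρ)))

product-block : ∀ {m} {D : Circ m} {f g d e} → Difference D f d → Difference D g e → Block D (6 + m) (f ⊗ g) (d + e)
product-block {m} {d = d} {e} x y =
  let e₁ , p₁ = append-inner op* x⁺ y⁺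
      e₂ , p₂ = append-inner op* (x⁻ ↑ e₁) (y⁻ ↑ e₁)
      e₁₂     = ⊑-trans e₁ e₂
      e₃ , p₃ = append-inner op* (x⁺ ↑ e₁₂) (y⁻ ↑ e₁₂)
      e₁₂₃    = ⊑-trans e₁₂ e₃
      e₄ , p₄ = append-inner op* (x⁻ ↑ e₁₂₃) (y⁺ ↑ e₁₂₃)
  in block-after (⊑-trans e₁₂₃ e₄) (block-cong rearrange (⊔-idem (d + e))
       (difference-of-sums (p₁ ↑ ⊑-trans (⊑-trans e₂ e₃) e₄) (p₂ ↑ ⊑-trans e₃ e₄) (p₃ ↑ e₄) p₄))
  where
  x⁺ = positive x
  x⁻ = negative x
  y⁺ = positive y
  y⁻ = negative y
  rearrange : _ ≋ _
  rearrange R ρ = CommutativeRing.trans R (RingIdentities.product-difference R _ _ _ _)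
                    (CommutativeRing.*-cong R (difference x R ρ) (difference y R ρ))

plusZero : ∀ {m} → Circ m → Gate m → Circ (3 + m)
plusZero {m} D u = ((D ▷ u) ▷ cst zero-c) ▷ add (inject₁ (fromℕ m)) (fromℕ (suc m))

-- u + 0 turns a (single-use) input gate into a reusable inner gate of degree 1.
plus-zero : ∀ {m} (D : Circ m) (u : Gate m) → isInputGate u ≡ true →
  D ⊑ plusZero D u × Inner (plusZero D u) (gatePoly D u ⊕ gatePoly (D ▷ u) (cst zero-c)) 1
plus-zero D u is-input =
  let e₂ , z = append op+ (operand-after-input (cst zero-c) refl (fresh-input D u is-input))
                          (fresh-input (D ▷ u) (cst zero-c) refl)
                          (λ same → ⊥-elim (fromℕ≢inject₁ (sym same)))
  in ⊑-trans e₁ e₂ , z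
  where
  e₁ : D ⊑ (D ▷ u) ▷ cst zero-c
  e₁ = ⊑-trans (snoc-⊑ D u (input-legal D u is-input))
               (snoc-⊑ (D ▷ u) (cst zero-c) (input-legal (D ▷ u) (cst zero-c) refl))

input-block : ∀ {m} (D : Circ m) (u : Gate m) → isInputGate u ≡ true → Block D (6 + m) (gatePoly D u) 1
input-block D u is-input =
  let e₁ , z₁ = plus-zero D u is-input
      e₂ , z₂ = plus-zero (plusZero D u) (cst zero-c) refl
  in block _ ≤-refl (⊑-trans e₁ e₂)
       (record { positive = z₁ ↑ e₂ ; negative = z₂
               ; difference = λ R ρ → RingIdentities.input-difference R (gatePoly D u R ρ) })

gate-block : ∀ {n m} {C : Circ n} {D : Circ m} (g : Gate n) → Encoding C D →
  Block D (6 + m) (gatePoly C g) (gateDeg (degrees C) g)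
gate-block {D = D} (var x)   enc = input-block D (var x) refl
gate-block {D = D} (cst c)   enc = input-block D (cst c) refl
gate-block         (add a b) enc = addition-block (enc a) (enc b)
gate-block         (mul a b) enc = product-block (enc a) (enc b)
gate-block         (sub a b) enc = subtraction-block (enc a) (enc b)

record Simulation {n} (C : Circ n) : Set₁ where
  field
    {size}     : ℕ
    circuit    : Circ size
    size-bound : size ≤ 6 * n
    legal      : Legal circuit
    encoding   : Encoding C circuit

simulate : ∀ {n} (C : Circ n) → Simulation C
simulate [] = record { circuit = [] ; size-bound = z≤n ; legal = (λ ()) , tt ; encoding = λ () }
simulate {suc n} (C ▷ g) = record
  { circuit    = Block.circuit B
  ; size-bound = ≤-trans (Block.small B) (≤-trans (+-monoʳ-≤ 6 size-bound) (≤-reflexive (sym (*-suc 6 n))))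
  ; legal      = keeps-legal (Block.extends B) legal
  ; encoding   = encoding-snoc {C = C} g (encoding-lift {C = C} (Block.extends B) encoding) (Block.result B)
  }
  where
  open Simulation (simulate C)
  B = gate-block {C = C} g encoding

output-gate : ∀ {k} (F : Circ (suc k)) {f d} (x : Inner F f d) → gate x ≡ fromℕ k →
  formalDegree F ≡ d × (∀ R ρ → CommutativeRing._≈_ R (output R F ρ) (f R ρ))
output-gate F x refl =
  trans (last≡lookup-fromℕ (degrees F)) (degree x) ,
  λ R ρ → CommutativeRing.trans R (CommutativeRing.reflexive R (last≡lookup-fromℕ (values R F ρ))) (computes x R ρ)

finish : ∀ {m} (D : Circ m) {f d} → Legal D → Difference D f d →
  Σ (Circ (3 + m)) λ F → Legal F × formalDegree F ≡ d + 1 × (∀ R ρ → CommutativeRing._≈_ R (output R F ρ) (f R ρ))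
finish {m} D {f} {d} legal x =
  let e₂ , negated = append op* (fresh-input D (cst minus-one) refl) (inner-operand (negative x ↑ e₁))
                                (λ same → ⊥-elim (fromℕ≢inject₁ same))
      e₃ , out = append-inner op+ (positive x ↑ ⊑-trans e₁ e₂) negated
      degree-eq , value-eq = output-gate F out refl
  in F , keeps-legal (⊑-trans (⊑-trans e₁ e₂) e₃) legal ,
     trans degree-eq (trans (m≤n⇒m⊔n≡n (n≤1+n d)) (+-comm 1 d)) ,
     λ R ρ → CommutativeRing.trans R (value-eq R ρ)
               (CommutativeRing.trans R (RingIdentities.minus-one-difference R _ _) (difference x R ρ))
  where
  F : Circ (3 + m)
  F = ((D ▷ cst minus-one) ▷ mul (fromℕ m) (inject₁ (gate (negative x))))
        ▷ add (inject₁ (inject₁ (gate (positive x)))) (fromℕ (suc m))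
  e₁ : D ⊑ D ▷ cst minus-one
  e₁ = snoc-⊑ D (cst minus-one) (input-legal D (cst minus-one) refl)

-- The theorem: simulate C with at most 6t gates, then finish at its output
-- gate with 3 more.

proposition1 : (n : ℕ) (C : Circ (suc n)) → InputFanoutOK C →
    Σ ℕ (λ m → Σ (Circ (suc m)) (λ C' →
      InputFanoutOK C' × NoSub C' ×
      formalDegree C' ≡ formalDegree C + 1 ×
      suc m ≤ 6 * suc n + 3 ×
      ((R : CommutativeRing 0ℓ 0ℓ) (ρ : ℕ → CommutativeRing.Carrier R) →
        CommutativeRing._≈_ R (output R C' ρ) (output R C ρ))))
proposition1 n C _ =
  let C' , (fanout-ok , no-sub) , degree-eq , value-eq = finish circuit legal (encoding (fromℕ n))
  in 2 + size , C' , fanout-ok , no-sub ,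
     trans degree-eq (cong (_+ 1) (sym (last≡lookup-fromℕ (degrees C)))) ,
     ≤-trans (+-monoʳ-≤ 3 size-bound) (≤-reflexive (+-comm 3 (6 * suc n))) ,
     λ R ρ → CommutativeRing.trans R (value-eq R ρ) (CommutativeRing.reflexive R (sym (last≡lookup-fromℕ (values R C ρ))))
  where
  open Simulation (simulate C)
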